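{- Let $G$ be the threshold graph on $n$ vertices generated by the sequence $x_1^{k_1},x_2^{k_2},\ldots,x_m^{k_m}$, where $x_i\in\{0,1\}$, $x_j\neq x_{j+1}$ for all $j\in\{1,\ldots,m-1\}$, $x_m=1$, and $k_1\geq 2$. Then $$\operatorname{cdim}(G)=\begin{cases} n-m & \text{if } k_m>1,\\ n-m+1 & \text{if } k_m=1.\end{cases}$$
   Context: All graphs are nonempty, finite, simple and undirected. For distinct vertices $v,w$ of a graph $G$, $\kappa(v,w)$ denotes the maximum number of internally vertex-disjoint $v$–$w$ paths in $G$; by convention $\kappa(v,v)=\infty$. For an ordered vertex set $W=\{w_1,\ldots,w_k\}\subseteq V(G)$, the connectivity representation of $v$ is $r(v,W)=[\kappa(v,w_1),\ldots,\kappa(v,w_k)]$. $W$ is resolving for $G$ if $r(v_1,W)=r(v_2,W)$ implies $v_1=v_2$ for all $v_1,v_2\in V(G)$. The connectivity dimension $\operatorname{cdim}(G)$ is the minimum cardinality of a resolving set of $G$. A threshold graph on $n$ vertices is generated by a binary sequence $y_1,\ldots,y_n$: starting from the empty graph, in step $i$ one adds a new vertex, which is isolated if $y_i=0$ and adjacent to all previously added vertices if $y_i=1$. The notation $x_1^{k_1},\ldots,x_m^{k_m}$ denotes the binary sequence consisting of $k_1$ consecutive copies of $x_1$, followed by $k_2$ consecutive copies of $x_2$, and so on, so $n=k_1+\cdots+k_m$. -}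

module Defs where

open import Data.Nat using (ℕ; _<_)
open import Data.Bool using (Bool; true; false; T)
open import Data.Fin using (Fin; toℕ)
open import Data.Fin.Subset using (Subset; _∈_)
open import Data.List using (List; []; _∷_; _++_; [_]; length; replicate; concatMap; allFin; lookup)
open import Data.List.Relation.Unary.All using (All)
open import Data.List.Relation.Unary.AllPairs using (AllPairs)
open import Data.List.Relation.Unary.Linked using (Linked)
open import Data.List.Relation.Unary.Unique.Propositional using (Unique)
import Data.List.Membership.Propositional as LM
open import Data.Product using (Σ; _×_)
open import Data.Sum using (_⊎_)
open import Relation.Binary.PropositionalEquality using (_≡_; _≢_)
open import Relation.Nullary using (¬_)

blockSeq : (m : ℕ) → (Fin m → Bool) → (Fin m → ℕ) → List Bool
blockSeq m x k = concatMap (λ i → replicate (k i) (x i)) (allFin m)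

-- The threshold graph generated by y_1,...,y_n has vertex set Fin n
-- (vertex i is the one added at step i+1).  For i added before j,
-- i and j are adjacent iff y_j = 1.
ThAdj : (ys : List Bool) → Fin (length ys) → Fin (length ys) → Set
ThAdj ys i j = (toℕ i < toℕ j × T (lookup ys j)) ⊎ (toℕ j < toℕ i × T (lookup ys i))

module _ {n : ℕ} (Adj : Fin n → Fin n → Set) where

  IsPath : Fin n → List (Fin n) → Fin n → Set
  IsPath v is w = Unique (v ∷ is ++ [ w ]) × Linked Adj (v ∷ is ++ [ w ])

  DisjointL : List (Fin n) → List (Fin n) → Set
  DisjointL as bs = ∀ z → z LM.∈ as → ¬ (z LM.∈ bs)

  HasDisjPaths : Fin n → Fin n → ℕ → Set
  HasDisjPaths v w c =
    Σ (List (List (Fin n))) λ ps →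
      length ps ≡ c
      × All (λ is → IsPath v is w) ps
      × AllPairs (λ as bs → as ≢ bs × DisjointL as bs) ps

  data ℕ∞ : Set where
    fin : ℕ → ℕ∞
    ∞   : ℕ∞

  -- KappaIs v w c  :⇔  κ(v,w) = c   (κ(v,v) = ∞ by convention;
  -- for v ≠ w, κ(v,w) is the maximum number of internally disjoint paths).
  KappaIs : Fin n → Fin n → ℕ∞ → Set
  KappaIs v w ∞       = v ≡ w
  KappaIs v w (fin c) = v ≢ w × HasDisjPaths v w c
                        × (∀ c′ → HasDisjPaths v w c′ → c′ Data.Nat.≤ c)

  SameKappa : Fin n → Fin n → Fin n → Set
  SameKappa v₁ v₂ w = Σ ℕ∞ λ c → KappaIs v₁ w c × KappaIs v₂ w c

  Resolving : Subset n → Set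
  Resolving W = ∀ v₁ v₂ → (∀ w → w ∈ W → SameKappa v₁ v₂ w) → v₁ ≡ v₂

  CDimIs : ℕ → Set
  CDimIs d = (Σ (Subset n) λ W → Resolving W × Data.Fin.Subset.∣ W ∣ ≡ d)
             × (∀ W → Resolving W → d Data.Nat.≤ Data.Fin.Subset.∣ W ∣)

{-# OPTIONS --safe #-}
-- In a threshold graph neighbourhoods are nested: N(u) ⊆ N[w] or N(w) ⊆ N[u] for all u, w.  If
-- N(v) ⊆ N[t], the paths v f t through the neighbours f of v give κ(v,t) = deg v, which is optimal
-- because disjoint paths leave v through distinct neighbours.  Two vertices of the same run of the
-- generating sequence are twins, so the transposition exchanging them is an automorphism fixing every
-- other vertex; hence a resolving set omits at most one vertex per run, and |W| ≥ n − m.  Conversely,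
-- omitting the last vertex of every run, with v_n traded for v_(n−1), leaves a resolving set: it
-- contains the dominating vertex v_n, and κ(v, v_n) = deg v tells the omitted vertices apart, since
-- their degrees differ once k₁ ≥ 2.  When k_m = 1 this omits only m − 1 vertices, and that is optimal:
-- no vertex other than themselves distinguishes v_n from the vertices of the last run of 1s before it.
module Submission where

open import Defs
open import Data.Nat using (ℕ; zero; suc; _+_; _∸_; _≤_; _<_; z≤n; s≤s; s≤s⁻¹; z<s; _<?_; _≤?_)
open import Data.Nat.Properties
  using ( ≤-refl; ≤-trans; ≤-antisym; ≤-total; <-trans; <-irrefl; <-asym; <⇒≤; <⇒≢; ≤-<-trans; <-≤-trans
        ; ≤∧≢⇒<; ≰⇒>; 1+n≰n; n≢0⇒n>0; n≤1+n; m<1+n⇒m≤n; m≤n⇒m<n∨m≡n; m≤n⇒m≤1+n; m≤n+m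
        ; +-comm; +-assoc; +-suc; +-identityʳ; +-monoʳ-≤; +-monoˡ-≤; +-cancelˡ-≡; +-cancelʳ-≡
        ; m+n≡0⇒m≡0; m+n≡0⇒n≡0; suc-injective; +-∸-comm; m≤n+o⇒m∸n≤o; m≤n+m∸n; module ≤-Reasoning )
open import Data.Bool using (Bool; true; false; not; T?; _xor_; if_then_else_)
import Data.Bool as Bool
open import Data.Bool.Properties using (T-≡; ¬-not)
open import Data.Fin using (Fin; toℕ; fromℕ; fromℕ<; inject₁; _≟_) renaming (zero to fzero; suc to fsuc)
import Data.Fin.Properties as FinP
open import Data.Fin.Properties using (toℕ-fromℕ<; toℕ-fromℕ; toℕ-inject₁)
open import Data.Fin.Subset using (Subset; ∣_∣; ∁; inside; outside) renaming (_∈_ to _∈ₛ_; _∉_ to _∉ₛ_)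
open import Data.Fin.Subset.Properties using (∣∁p∣≡n∸∣p∣; x∈∁p⇒x∉p; x∉∁p⇒x∈p; x∉p⇒x∈∁p; _∈?_)
open import Data.Fin.Permutation using (Permutation; _⟨$⟩ʳ_; _⟨$⟩ˡ_; inverseˡ; inverseʳ)
import Data.Fin.Permutation as Perm
import Data.Fin.Permutation.Components as PC
open import Data.Vec using ([]; _∷_) renaming (here to hereₛ; there to thereₛ)
open import Data.List
  using (List; []; _∷_; _++_; [_]; length; lookup; map; filter; allFin; upTo; replicate; concat; tabulate
        ; reverse; reverseAcc)
open import Data.List.Properties
  using ( length-++; length-++-sucʳ; length-map; length-upTo; ++-assoc; map-++; map-injective; map-tabulate
        ; unfold-reverse; reverse-++; reverse-injective )
open import Data.List.Relation.Unary.All as All using (All; []; _∷_)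
import Data.List.Relation.Unary.All.Properties as All
open import Data.List.Relation.Unary.Any using (here; there)
import Data.List.Relation.Unary.Any.Properties as Any
open import Data.List.Relation.Unary.AllPairs as AllPairs using (AllPairs; []; _∷_)
import Data.List.Relation.Unary.AllPairs.Properties as AllPairs
open import Data.List.Relation.Unary.Linked as Linked using (Linked; []; [-]; _∷_)
import Data.List.Relation.Unary.Linked.Properties as Linked
open import Data.List.Relation.Unary.Unique.Propositional using (Unique)
import Data.List.Relation.Unary.Unique.Propositional.Properties as Unique
open import Data.List.Membership.Propositional using (_∈_)
open import Data.List.Membership.Propositional.Properties
  using (∈-∃++; ∈-++⁺ˡ; ∈-++⁺ʳ; ∈-++⁻; ∈-map⁻; ∈-filter⁺; ∈-filter⁻; ∈-allFin; ∈-upTo⁺)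
open import Data.Product using (Σ; _×_; _,_; proj₂)
open import Data.Sum using (_⊎_; inj₁; inj₂; [_,_]′)
import Data.Sum as Sum
open import Function using (id; _∘_; _⇔_; Equivalence; mk⇔)
import Function.Properties.Equivalence as ⇔
open import Relation.Binary.Definitions using (Symmetric; Decidable; tri<; tri≈; tri>)
open import Relation.Nullary using (¬_; Dec; yes; no; contradiction)
open import Relation.Nullary.Decidable using (_×-dec_; _⊎-dec_)
open import Relation.Binary.PropositionalEquality
  using (_≡_; _≢_; refl; sym; trans; cong; cong₂; subst; subst₂; ≢-sym; module ≡-Reasoning)

module _ {a} {A : Set a} where

  Unique-⊆⇒length≤ : ∀ {xs ys : List A} → Unique xs → (∀ {x} → x ∈ xs → x ∈ ys) → length xs ≤ length ys
  Unique-⊆⇒length≤ {[]} _ _ = z≤n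
  Unique-⊆⇒length≤ {x ∷ xs} (x∉xs ∷ uxs) xs⊆ys with as , bs , refl ← ∈-∃++ (xs⊆ys (here refl)) =
    subst (suc (length xs) ≤_) (sym (length-++-sucʳ as x bs)) (s≤s (Unique-⊆⇒length≤ uxs xs⊆as++bs))
    where
    xs⊆as++bs : ∀ {y} → y ∈ xs → y ∈ as ++ bs
    xs⊆as++bs y∈xs with ∈-++⁻ as (xs⊆ys (there y∈xs))
    ... | inj₁ y∈as         = ∈-++⁺ˡ y∈as
    ... | inj₂ (here refl)  = contradiction refl (All.lookup x∉xs y∈xs)
    ... | inj₂ (there y∈bs) = ∈-++⁺ʳ as y∈bs

  Unique-map⁺-on : ∀ {b} {B : Set b} {xs : List A} (f : A → B) →
                   (∀ {x y} → x ∈ xs → y ∈ xs → f x ≡ f y → x ≡ y) → Unique xs → Unique (map f xs)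
  Unique-map⁺-on f inj [] = []
  Unique-map⁺-on f inj (x∉xs ∷ uxs) =
    All.map⁺ (All.tabulate λ y∈xs fx≡fy → All.lookup x∉xs y∈xs (inj (here refl) (there y∈xs) fx≡fy))
    ∷ Unique-map⁺-on f (λ x∈ y∈ → inj (there x∈) (there y∈)) uxs

module _ {a r} {A : Set a} {R : A → A → Set r} (R-sym : Symmetric R) where

  AllPairs-reverse : ∀ {xs} → AllPairs R xs → AllPairs R (reverse xs)
  AllPairs-reverse {[]} [] = []
  AllPairs-reverse {x ∷ xs} (Rx ∷ Rxs) rewrite unfold-reverse x xs =
    AllPairs.++⁺ (AllPairs-reverse Rxs) ([] ∷ [])
      (All.tabulate λ y∈ → R-sym (All.lookup Rx (Any.reverse⁻ y∈)) ∷ [])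

  private
    Linked-reverseAcc : ∀ {x acc xs} → Linked R (x ∷ acc) → Linked R (x ∷ xs) →
                        Linked R (reverseAcc (x ∷ acc) xs)
    Linked-reverseAcc Racc [-]         = Racc
    Linked-reverseAcc Racc (Rxy ∷ Rxs) = Linked-reverseAcc (R-sym Rxy ∷ Racc) Rxs

  Linked-reverse : ∀ {xs} → Linked R xs → Linked R (reverse xs)
  Linked-reverse {[]}    []  = []
  Linked-reverse {_ ∷ _} Rxs = Linked-reverseAcc [-] Rxs

members : ∀ {n} → Subset n → List (Fin n)
members []            = []
members (inside ∷ p)  = fzero ∷ map fsuc (members p)
members (outside ∷ p) = map fsuc (members p)

length-members : ∀ {n} (p : Subset n) → length (members p) ≡ ∣ p ∣
length-members []            = refl
length-members (inside ∷ p)  = cong suc (trans (length-map fsuc (members p)) (length-members p))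
length-members (outside ∷ p) = trans (length-map fsuc (members p)) (length-members p)

members-unique : ∀ {n} (p : Subset n) → Unique (members p)
members-unique []            = []
members-unique (inside ∷ p)  = All.map⁺ (All.universal (λ _ ()) _) ∷ Unique.map⁺ FinP.suc-injective (members-unique p)
members-unique (outside ∷ p) = Unique.map⁺ FinP.suc-injective (members-unique p)

∈-members⁻ : ∀ {n} (p : Subset n) {x} → x ∈ members p → x ∈ₛ p
∈-members⁻ (inside ∷ p) (here refl) = hereₛ
∈-members⁻ (inside ∷ p) (there x∈)  with _ , y∈ , refl ← ∈-map⁻ fsuc x∈ = thereₛ (∈-members⁻ p y∈)
∈-members⁻ (outside ∷ p) x∈        with _ , y∈ , refl ← ∈-map⁻ fsuc x∈ = thereₛ (∈-members⁻ p y∈)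

injectiveOn⇒∣p∣≤ : ∀ {n c} (p : Subset n) (f : Fin n → ℕ) →
                   (∀ {x y} → x ∈ₛ p → y ∈ₛ p → f x ≡ f y → x ≡ y) → (∀ {x} → x ∈ₛ p → f x < c) →
                   ∣ p ∣ ≤ c
injectiveOn⇒∣p∣≤ {c = c} p f inj f<c = begin
  ∣ p ∣                      ≡⟨ sym (length-members p) ⟩
  length (members p)         ≡⟨ sym (length-map f (members p)) ⟩
  length (map f (members p)) ≤⟨ Unique-⊆⇒length≤ unique image⊆ ⟩
  length (upTo c)            ≡⟨ length-upTo c ⟩
  c                          ∎
  where
  open ≤-Reasoning
  unique : Unique (map f (members p))
  unique = Unique-map⁺-on f (λ x∈ y∈ → inj (∈-members⁻ p x∈) (∈-members⁻ p y∈)) (members-unique p)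
  image⊆ : ∀ {z} → z ∈ map f (members p) → z ∈ upTo c
  image⊆ z∈ with _ , x∈ , refl ← ∈-map⁻ f z∈ = ∈-upTo⁺ (f<c (∈-members⁻ p x∈))

-- Local connectivity

module Graph {n : ℕ} (Adj : Fin n → Fin n → Set) (adj? : Decidable Adj)
             (adj-sym : Symmetric Adj) (adj-irrefl : ∀ {v} → ¬ Adj v v) where

  neighbours : Fin n → List (Fin n)
  neighbours v = filter (adj? v) (allFin n)

  degree : Fin n → ℕ
  degree v = length (neighbours v)

  neighbours-unique : ∀ v → Unique (neighbours v)
  neighbours-unique v = Unique.filter⁺ (adj? v) (Unique.allFin⁺ n)

  ∈-neighbours⁺ : ∀ {v f} → Adj v f → f ∈ neighbours v
  ∈-neighbours⁺ {v} {f} = ∈-filter⁺ (adj? v) (∈-allFin f)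

  ∈-neighbours⁻ : ∀ {v f} → f ∈ neighbours v → Adj v f
  ∈-neighbours⁻ {v} f∈ = proj₂ (∈-filter⁻ (adj? v) {xs = allFin n} f∈)

  firstStep : Fin n → List (Fin n) → Fin n
  firstStep w []      = w
  firstStep w (f ∷ _) = f

  IsPath⇒Adj-firstStep : ∀ {v is w} → IsPath Adj v is w → Adj v (firstStep w is)
  IsPath⇒Adj-firstStep {is = []}    (_ , Avw ∷ _) = Avw
  IsPath⇒Adj-firstStep {is = _ ∷ _} (_ , Avf ∷ _) = Avf

  firstStep-injective : ∀ {v as bs w} → IsPath Adj v as w → IsPath Adj v bs w →
                        as ≢ bs → DisjointL Adj as bs → firstStep w as ≢ firstStep w bs
  firstStep-injective {as = []}    {[]}     _ _ as≢bs _ _ = as≢bs refl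
  firstStep-injective {as = []}    {b ∷ bs} _ ((_ ∷ b∉ ∷ _) , _) _ _ w≡b =
    All.lookup b∉ (∈-++⁺ʳ bs (here refl)) (sym w≡b)
  firstStep-injective {as = a ∷ as} {[]}    ((_ ∷ a∉ ∷ _) , _) _ _ _ a≡w =
    All.lookup a∉ (∈-++⁺ʳ as (here refl)) a≡w
  firstStep-injective {as = a ∷ _}  {_ ∷ _} _ _ _ disjoint a≡b = disjoint a (here refl) (here a≡b)

  firstSteps-unique : ∀ {v w ps} → All (λ is → IsPath Adj v is w) ps →
                      AllPairs (λ as bs → as ≢ bs × DisjointL Adj as bs) ps → Unique (map (firstStep w) ps)
  firstSteps-unique [] [] = []
  firstSteps-unique (path ∷ paths) (apart ∷ aparts) =
    All.map⁺ (All.zipWith (λ (path′ , (distinct , disjoint)) → firstStep-injective path path′ distinct disjoint) (paths , apart))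
    ∷ firstSteps-unique paths aparts

  HasDisjPaths⇒≤degree : ∀ {v w c} → HasDisjPaths Adj v w c → c ≤ degree v
  HasDisjPaths⇒≤degree {v} {w} (ps , refl , paths , aparts) =
    subst (_≤ degree v) (length-map (firstStep w) ps) (Unique-⊆⇒length≤ (firstSteps-unique paths aparts) firstSteps⊆)
    where
    firstSteps⊆ : ∀ {f} → f ∈ map (firstStep w) ps → f ∈ neighbours v
    firstSteps⊆ f∈ with _ , p∈ , refl ← ∈-map⁻ (firstStep w) f∈ =
      ∈-neighbours⁺ (IsPath⇒Adj-firstStep (All.lookup paths p∈))

  KappaIs-functional : ∀ {v w c d} → KappaIs Adj v w (fin c) → KappaIs Adj v w (fin d) → c ≡ d
  KappaIs-functional (_ , paths-c , max-c) (_ , paths-d , max-d) = ≤-antisym (max-d _ paths-c) (max-c _ paths-d)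

  _≼_ : Fin n → Fin n → Set
  v ≼ t = ∀ f → Adj v f → f ≢ t → Adj t f

  module _ {v t} (v≢t : v ≢ t) (v≼t : v ≼ t) where

    private
      via : Fin n → List (Fin n)
      via f with f ≟ t
      ... | yes _ = []
      ... | no _  = [ f ]

      via-IsPath : ∀ {f} → Adj v f → IsPath Adj v (via f) t
      via-IsPath {f} Avf with f ≟ t
      ... | yes refl = ((v≢t ∷ []) ∷ [] ∷ []) , Avf ∷ [-]
      ... | no f≢t   = ((v≢f ∷ v≢t ∷ []) ∷ (f≢t ∷ []) ∷ [] ∷ []) , Avf ∷ adj-sym (v≼t f Avf f≢t) ∷ [-]
        where
        v≢f : v ≢ f
        v≢f refl = adj-irrefl Avf

      via-apart : ∀ {f g} → f ≢ g → via f ≢ via g × DisjointL Adj (via f) (via g)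
      via-apart {f} {g} f≢g with f ≟ t | g ≟ t
      ... | yes refl | yes refl = contradiction refl f≢g
      ... | yes _    | no _     = (λ ()) , (λ _ ())
      ... | no _     | yes _    = (λ ()) , (λ _ _ ())
      ... | no _     | no _     = (λ { refl → f≢g refl }) , λ { _ (here refl) (here f≡g) → f≢g f≡g }

    ≼⇒HasDisjPaths : HasDisjPaths Adj v t (degree v)
    ≼⇒HasDisjPaths = map via (neighbours v) , length-map via (neighbours v)
                   , All.map⁺ (All.tabulate (via-IsPath ∘ ∈-neighbours⁻))
                   , AllPairs.map⁺ (AllPairs.map via-apart (neighbours-unique v))

    ≼⇒κ≡degree : KappaIs Adj v t (fin (degree v))
    ≼⇒κ≡degree = v≢t , ≼⇒HasDisjPaths , λ _ → HasDisjPaths⇒≤degree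

  IsPath-reverse : ∀ {v is w} → IsPath Adj v is w → IsPath Adj w (reverse is) v
  IsPath-reverse {v} {is} {w} (unique , linked) =
    subst Unique reversed (AllPairs-reverse ≢-sym unique) ,
    subst (Linked Adj) reversed (Linked-reverse adj-sym linked)
    where
    reversed : reverse (v ∷ is ++ [ w ]) ≡ w ∷ reverse is ++ [ v ]
    reversed = trans (unfold-reverse v (is ++ [ w ])) (cong (_++ [ v ]) (reverse-++ is [ w ]))

  HasDisjPaths-sym : ∀ {v w c} → HasDisjPaths Adj v w c → HasDisjPaths Adj w v c
  HasDisjPaths-sym (ps , refl , paths , aparts) =
    map reverse ps , length-map reverse ps ,
    All.map⁺ (All.map IsPath-reverse paths) , AllPairs.map⁺ (AllPairs.map reverse-apart aparts)
    where
    reverse-apart : ∀ {as bs} → as ≢ bs × DisjointL Adj as bs →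
                    reverse as ≢ reverse bs × DisjointL Adj (reverse as) (reverse bs)
    reverse-apart (as≢bs , disjoint) =
      as≢bs ∘ reverse-injective , λ z z∈as z∈bs → disjoint z (Any.reverse⁻ z∈as) (Any.reverse⁻ z∈bs)

  KappaIs-sym : ∀ {v w c} → KappaIs Adj v w (fin c) → KappaIs Adj w v (fin c)
  KappaIs-sym (v≢w , paths , max) = ≢-sym v≢w , HasDisjPaths-sym paths , λ c′ → max c′ ∘ HasDisjPaths-sym

  module _ (σ : Fin n → Fin n) (σ-injective : ∀ {x y} → σ x ≡ σ y → x ≡ y)
           (σ-Adj : ∀ {a b} → Adj a b → Adj (σ a) (σ b)) where

    IsPath-map : ∀ {v is w} → IsPath Adj v is w → IsPath Adj (σ v) (map σ is) (σ w)
    IsPath-map {v} {is} {w} (unique , linked) =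
      subst Unique mapped (Unique.map⁺ σ-injective unique) ,
      subst (Linked Adj) mapped (Linked.map⁺ (Linked.map σ-Adj linked))
      where
      mapped : map σ (v ∷ is ++ [ w ]) ≡ σ v ∷ map σ is ++ [ σ w ]
      mapped = cong (σ v ∷_) (map-++ σ is [ w ])

    HasDisjPaths-map : ∀ {v w c} → HasDisjPaths Adj v w c → HasDisjPaths Adj (σ v) (σ w) c
    HasDisjPaths-map (ps , refl , paths , aparts) =
      map (map σ) ps , length-map (map σ) ps ,
      All.map⁺ (All.map IsPath-map paths) , AllPairs.map⁺ (AllPairs.map map-apart aparts)
      where
      map-apart : ∀ {as bs} → as ≢ bs × DisjointL Adj as bs →
                  map σ as ≢ map σ bs × DisjointL Adj (map σ as) (map σ bs)
      map-apart {as} {bs} (as≢bs , disjoint) = as≢bs ∘ map-injective σ-injective , λ _ → apart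
        where
        apart : ∀ {z} → z ∈ map σ as → ¬ z ∈ map σ bs
        apart z∈as z∈bs with a , a∈as , refl ← ∈-map⁻ σ z∈as | b , b∈bs , σa≡σb ← ∈-map⁻ σ z∈bs =
          disjoint a a∈as (subst (_∈ _) (sym (σ-injective σa≡σb)) b∈bs)

  IsAutomorphism : Permutation n n → Set
  IsAutomorphism π = (∀ {a b} → Adj a b → Adj (π ⟨$⟩ʳ a) (π ⟨$⟩ʳ b))
                   × (∀ {a b} → Adj a b → Adj (π ⟨$⟩ˡ a) (π ⟨$⟩ˡ b))

  KappaIs-automorphism : ∀ π → IsAutomorphism π → ∀ {v w c} →
                         KappaIs Adj v w (fin c) → KappaIs Adj (π ⟨$⟩ʳ v) (π ⟨$⟩ʳ w) (fin c)
  KappaIs-automorphism π (π-Adj , π⁻¹-Adj) {v} {w} (v≢w , paths , max) =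
    v≢w ∘ πʳ-injective , HasDisjPaths-map (π ⟨$⟩ʳ_) πʳ-injective π-Adj paths ,
    λ c′ paths′ → max c′ (subst₂ (λ x y → HasDisjPaths Adj x y c′) (inverseˡ π) (inverseˡ π)
                                 (HasDisjPaths-map (π ⟨$⟩ˡ_) πˡ-injective π⁻¹-Adj paths′))
    where
    πʳ-injective : ∀ {x y} → π ⟨$⟩ʳ x ≡ π ⟨$⟩ʳ y → x ≡ y
    πʳ-injective {x} {y} eq = trans (sym (inverseˡ π)) (trans (cong (π ⟨$⟩ˡ_) eq) (inverseˡ π))
    πˡ-injective : ∀ {x y} → π ⟨$⟩ˡ x ≡ π ⟨$⟩ˡ y → x ≡ y
    πˡ-injective {x} {y} eq = trans (sym (inverseʳ π)) (trans (cong (π ⟨$⟩ʳ_) eq) (inverseʳ π))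

  Twins : Fin n → Fin n → Set
  Twins u v = ∀ f → f ≢ u → f ≢ v → Adj u f ⇔ Adj v f

  Twins-sym : ∀ {u v} → Twins u v → Twins v u
  Twins-sym twins f f≢v f≢u = ⇔.sym (twins f f≢u f≢v)

  private
    data Swapped (u v : Fin n) : Fin n → Fin n → Set where
      swap-u : Swapped u v u v
      swap-v : Swapped u v v u
      fixed  : ∀ {x} → x ≢ u → x ≢ v → Swapped u v x x

    swapped : ∀ u v x → Swapped u v x (PC.transpose u v x)
    swapped u v x with x ≟ u
    ... | yes refl = swap-u
    ... | no x≢u with x ≟ v
    ...   | yes refl = swap-v
    ...   | no x≢v   = fixed x≢u x≢v

  transpose-matchˡ : ∀ u v → PC.transpose u v u ≡ v
  transpose-matchˡ u v with PC.transpose u v u | swapped u v u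
  ... | _ | swap-u       = refl
  ... | _ | swap-v       = refl
  ... | _ | fixed u≢u _  = contradiction refl u≢u

  transpose-matchʳ : ∀ u v → PC.transpose u v v ≡ u
  transpose-matchʳ u v with PC.transpose u v v | swapped u v v
  ... | _ | swap-u       = refl
  ... | _ | swap-v       = refl
  ... | _ | fixed _ v≢v  = contradiction refl v≢v

  transpose-mismatch : ∀ {u v x} → x ≢ u → x ≢ v → PC.transpose u v x ≡ x
  transpose-mismatch {u} {v} {x} x≢u x≢v with PC.transpose u v x | swapped u v x
  ... | _ | swap-u    = contradiction refl x≢u
  ... | _ | swap-v    = contradiction refl x≢v
  ... | _ | fixed _ _ = refl

  transpose-Adj : ∀ {u v} → Twins u v → ∀ {a b} → Adj a b → Adj (PC.transpose u v a) (PC.transpose u v b)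
  transpose-Adj {u} {v} twins {a} {b} Aab with PC.transpose u v a | swapped u v a | PC.transpose u v b | swapped u v b
  ... | _ | swap-u         | _ | swap-u         = contradiction Aab adj-irrefl
  ... | _ | swap-u         | _ | swap-v         = adj-sym Aab
  ... | _ | swap-u         | _ | fixed b≢u b≢v  = Equivalence.to (twins b b≢u b≢v) Aab
  ... | _ | swap-v         | _ | swap-u         = adj-sym Aab
  ... | _ | swap-v         | _ | swap-v         = contradiction Aab adj-irrefl
  ... | _ | swap-v         | _ | fixed b≢u b≢v  = Equivalence.from (twins b b≢u b≢v) Aab
  ... | _ | fixed a≢u a≢v  | _ | swap-u         = adj-sym (Equivalence.to (twins a a≢u a≢v) (adj-sym Aab))
  ... | _ | fixed a≢u a≢v  | _ | swap-v         = adj-sym (Equivalence.from (twins a a≢u a≢v) (adj-sym Aab))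
  ... | _ | fixed _ _      | _ | fixed _ _      = Aab

  Twins⇒IsAutomorphism : ∀ {u v} → Twins u v → IsAutomorphism (Perm.transpose u v)
  Twins⇒IsAutomorphism twins = transpose-Adj twins , transpose-Adj (Twins-sym twins)

  Indistinguishable : Fin n → Fin n → Set
  Indistinguishable u v = ∀ w → w ≢ u → w ≢ v → SameKappa Adj u v w

  Twins⇒Indistinguishable : ∀ {u v} → Twins u v → (∀ w → u ≢ w → Σ ℕ λ c → KappaIs Adj u w (fin c)) →
                            Indistinguishable u v
  Twins⇒Indistinguishable {u} {v} twins κ w w≢u w≢v with c , κuw ← κ w (≢-sym w≢u) =
    fin c , κuw , subst₂ (λ x y → KappaIs Adj x y (fin c)) (transpose-matchˡ u v) (transpose-mismatch w≢u w≢v)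
                         (KappaIs-automorphism (Perm.transpose u v) (Twins⇒IsAutomorphism twins) κuw)

  ≼-both⇒Indistinguishable : ∀ {u v} → (∀ w → w ≢ u → w ≢ v → w ≼ u × w ≼ v) → Indistinguishable u v
  ≼-both⇒Indistinguishable ≼-both w w≢u w≢v with w≼u , w≼v ← ≼-both w w≢u w≢v =
    fin (degree w) , KappaIs-sym (≼⇒κ≡degree w≢u w≼u) , KappaIs-sym (≼⇒κ≡degree w≢v w≼v)

  SameKappa-sym : ∀ {v₁ v₂ w} → SameKappa Adj v₁ v₂ w → SameKappa Adj v₂ v₁ w
  SameKappa-sym (c , κ₁ , κ₂) = c , κ₂ , κ₁

  SameKappa-self : ∀ {v₁ v₂} → SameKappa Adj v₁ v₂ v₁ → v₂ ≡ v₁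
  SameKappa-self (∞     , _ , v₂≡v₁)       = v₂≡v₁
  SameKappa-self (fin _ , (v₁≢v₁ , _) , _) = contradiction refl v₁≢v₁

  Resolving-Indistinguishable : ∀ {W u v} → Resolving Adj W → Indistinguishable u v → u ∉ₛ W → v ∉ₛ W → u ≡ v
  Resolving-Indistinguishable resolving same u∉W v∉W =
    resolving _ _ λ w w∈W → same w (λ { refl → u∉W w∈W }) (λ { refl → v∉W w∈W })

  ≼-degree-< : ∀ {s b e} → s ≼ b → Adj b e → ¬ Adj s e → e ≢ s → degree s < degree b
  ≼-degree-< {s} {b} {e} s≼b Abe ¬Ase e≢s =
    subst (λ d → suc d ≤ degree b) (length-map σ (neighbours s)) (Unique-⊆⇒length≤ unique ⊆neighbours)
    where
    σ : Fin n → Fin n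
    σ = PC.transpose s b
    σ-injective : ∀ {x y} → σ x ≡ σ y → x ≡ y
    σ-injective eq = trans (sym (PC.transpose-inverse b s)) (trans (cong (PC.transpose b s) eq) (PC.transpose-inverse b s))
    e≢b : e ≢ b
    e≢b refl = adj-irrefl Abe
    σe≡e : σ e ≡ e
    σe≡e = transpose-mismatch e≢s e≢b
    unique : Unique (e ∷ map σ (neighbours s))
    unique = All.map⁺ (All.tabulate λ f∈ e≡σf →
                         ¬Ase (subst (Adj s) (σ-injective (trans (sym e≡σf) (sym σe≡e))) (∈-neighbours⁻ f∈)))
           ∷ Unique.map⁺ σ-injective (neighbours-unique s)
    σ-neighbour : ∀ {f} → Adj s f → Adj b (σ f)
    σ-neighbour {f} Asf with f ≟ b
    ... | yes refl = subst (Adj f) (sym (transpose-matchʳ s f)) (adj-sym Asf)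
    ... | no f≢b   = subst (Adj b) (sym (transpose-mismatch (λ { refl → adj-irrefl Asf }) f≢b)) (s≼b f Asf f≢b)
    ⊆neighbours : ∀ {x} → x ∈ e ∷ map σ (neighbours s) → x ∈ neighbours b
    ⊆neighbours (here refl) = ∈-neighbours⁺ Abe
    ⊆neighbours (there x∈) with f , f∈ , refl ← ∈-map⁻ σ x∈ = ∈-neighbours⁺ (σ-neighbour (∈-neighbours⁻ f∈))

  Separates : Fin n → Fin n → Fin n → Set
  Separates e u v = e ≢ u × e ≢ v × (Adj u e × ¬ Adj v e ⊎ Adj v e × ¬ Adj u e)

  Separates⇒degree≢ : ∀ {e u v} → u ≼ v ⊎ v ≼ u → Separates e u v → degree u ≢ degree v
  Separates⇒degree≢ (inj₁ u≼v) (e≢u , e≢v , inj₁ (Aue , ¬Ave)) = contradiction (u≼v _ Aue e≢v) ¬Ave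
  Separates⇒degree≢ (inj₁ u≼v) (e≢u , e≢v , inj₂ (Ave , ¬Aue)) = <⇒≢ (≼-degree-< u≼v Ave ¬Aue e≢u)
  Separates⇒degree≢ (inj₂ v≼u) (e≢u , e≢v , inj₁ (Aue , ¬Ave)) = ≢-sym (<⇒≢ (≼-degree-< v≼u Aue ¬Ave e≢v))
  Separates⇒degree≢ (inj₂ v≼u) (e≢u , e≢v , inj₂ (Ave , ¬Aue)) = contradiction (v≼u _ Ave e≢u) ¬Aue

m∸n≡m∸[1+n]+1 : ∀ {m n} → n < m → m ∸ n ≡ m ∸ suc n + 1
m∸n≡m∸[1+n]+1 {m} {n} n<m = trans (cong (_∸ suc n) (+-comm 1 m)) (+-∸-comm 1 n<m)

CDimIs-∁ : ∀ {n c} {Adj : Fin n → Fin n → Set} (E : Subset n) → ∣ E ∣ ≡ c → Resolving Adj (∁ E) →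
           (∀ W → Resolving Adj W → ∣ ∁ W ∣ ≤ c) → CDimIs Adj (n ∸ c)
CDimIs-∁ {n} {c} E refl resolving bound = (∁ E , resolving , ∣∁p∣≡n∸∣p∣ E) , λ W resolving′ →
  m≤n+o⇒m∸n≤o n c (begin
    n                  ≤⟨ m≤n+m∸n n ∣ W ∣ ⟩
    ∣ W ∣ + (n ∸ ∣ W ∣) ≡⟨ cong (∣ W ∣ +_) (sym (∣∁p∣≡n∸∣p∣ W)) ⟩
    ∣ W ∣ + ∣ ∁ W ∣     ≤⟨ +-monoʳ-≤ ∣ W ∣ (bound W resolving′) ⟩
    ∣ W ∣ + c           ≡⟨ +-comm ∣ W ∣ c ⟩
    c + ∣ W ∣           ∎)
  where open ≤-Reasoning

-- Threshold graphs and the runs of their generating sequence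

-- A total lookup (false past the end), so that positions need no bound proofs.
valueAt : List Bool → ℕ → Bool
valueAt []       _       = false
valueAt (y ∷ _)  zero    = y
valueAt (_ ∷ ys) (suc p) = valueAt ys p

lookup≡valueAt : ∀ ys (i : Fin (length ys)) → lookup ys i ≡ valueAt ys (toℕ i)
lookup≡valueAt (_ ∷ _)  fzero    = refl
lookup≡valueAt (_ ∷ ys) (fsuc i) = lookup≡valueAt ys i

valueAt-++ : ∀ xs ys p → valueAt (xs ++ ys) (length xs + p) ≡ valueAt ys p
valueAt-++ []       ys p = refl
valueAt-++ (_ ∷ xs) ys p = valueAt-++ xs ys p

changeAt : Bool → List Bool → ℕ
changeAt y []       = 0
changeAt y (y′ ∷ _) = if y xor y′ then 1 else 0

changes : List Bool → ℕ
changes []       = 0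
changes (y ∷ ys) = changeAt y ys + changes ys

runIndex : List Bool → ℕ → ℕ
runIndex []       _       = 0
runIndex (_ ∷ _)  zero    = 0
runIndex (y ∷ ys) (suc p) = changeAt y ys + runIndex ys p

changeAt≡0⇒≡ : ∀ y y′ ys → changeAt y (y′ ∷ ys) ≡ 0 → y ≡ y′
changeAt≡0⇒≡ true  true  _ _ = refl
changeAt≡0⇒≡ false false _ _ = refl

changeAt≤1 : ∀ y ys → changeAt y ys ≤ 1
changeAt≤1 _     []          = z≤n
changeAt≤1 true  (true  ∷ _) = z≤n
changeAt≤1 true  (false ∷ _) = ≤-refl
changeAt≤1 false (true  ∷ _) = ≤-refl
changeAt≤1 false (false ∷ _) = z≤n

changes<length : ∀ ys → 0 < length ys → changes ys < length ys
changes<length (y ∷ [])      _ = s≤s z≤n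
changes<length (y ∷ y′ ∷ ys) _ =
  s≤s (≤-trans (+-monoˡ-≤ (changes (y′ ∷ ys)) (changeAt≤1 y (y′ ∷ ys))) (changes<length (y′ ∷ ys) z<s))

runIndex-mono : ∀ ys {p q} → p ≤ q → runIndex ys p ≤ runIndex ys q
runIndex-mono []       _                         = z≤n
runIndex-mono (_ ∷ _)  {zero}          _         = z≤n
runIndex-mono (y ∷ ys) {suc p} {suc q} (s≤s p≤q) = +-monoʳ-≤ (changeAt y ys) (runIndex-mono ys p≤q)

runIndex≤changes : ∀ ys p → runIndex ys p ≤ changes ys
runIndex≤changes []       _       = z≤n
runIndex≤changes (_ ∷ _)  zero    = z≤n
runIndex≤changes (y ∷ ys) (suc p) = +-monoʳ-≤ (changeAt y ys) (runIndex≤changes ys p)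

runIndex-≡⇒valueAt-≡ : ∀ ys {p q} → p ≤ q → q < length ys → runIndex ys p ≡ runIndex ys q →
                       valueAt ys p ≡ valueAt ys q
runIndex-≡⇒valueAt-≡ (_ ∷ _)       {zero} {zero}  _ _ _ = refl
runIndex-≡⇒valueAt-≡ (y ∷ y′ ∷ ys) {zero} {suc q} _ (s≤s q<n) 0≡r =
  trans (changeAt≡0⇒≡ y y′ ys (m+n≡0⇒m≡0 _ (sym 0≡r)))
        (runIndex-≡⇒valueAt-≡ (y′ ∷ ys) z≤n q<n (sym (m+n≡0⇒n≡0 (changeAt y (y′ ∷ ys)) (sym 0≡r))))
runIndex-≡⇒valueAt-≡ (y ∷ ys) {suc p} {suc q} (s≤s p≤q) (s≤s q<n) r≡r =
  runIndex-≡⇒valueAt-≡ ys p≤q q<n (+-cancelˡ-≡ (changeAt y ys) _ _ r≡r)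

runIndex-≡⇒constant : ∀ ys {p f q} → p ≤ f → f ≤ q → q < length ys → runIndex ys p ≡ runIndex ys q →
                      valueAt ys f ≡ valueAt ys p
runIndex-≡⇒constant ys p≤f f≤q q<n rp≡rq =
  sym (runIndex-≡⇒valueAt-≡ ys p≤f (≤-<-trans f≤q q<n)
        (≤-antisym (runIndex-mono ys p≤f) (subst (_ ≤_) (sym rp≡rq) (runIndex-mono ys f≤q))))

module Threshold (ys : List Bool) where

  Y : Fin (length ys) → Bool
  Y i = valueAt ys (toℕ i)

  Adj : Fin (length ys) → Fin (length ys) → Set
  Adj = ThAdj ys

  Adj-<⁺ : ∀ {i j} → toℕ i < toℕ j → Y j ≡ true → Adj i j
  Adj-<⁺ {j = j} i<j Yj = inj₁ (i<j , Equivalence.from T-≡ (trans (lookup≡valueAt ys j) Yj))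

  Adj-<⁻ : ∀ {i j} → toℕ i < toℕ j → Adj i j → Y j ≡ true
  Adj-<⁻ {j = j} _   (inj₁ (_ , Tj))  = trans (sym (lookup≡valueAt ys j)) (Equivalence.to T-≡ Tj)
  Adj-<⁻         i<j (inj₂ (j<i , _)) = contradiction i<j (<-asym j<i)

  Adj->⁺ : ∀ {i j} → toℕ j < toℕ i → Y i ≡ true → Adj i j
  Adj->⁺ {i} {j} j<i Yi = inj₂ (j<i , Equivalence.from T-≡ (trans (lookup≡valueAt ys i) Yi))

  Adj->⁻ : ∀ {i j} → toℕ j < toℕ i → Adj i j → Y i ≡ true
  Adj->⁻ j<i (inj₁ (i<j , _)) = contradiction i<j (<-asym j<i)
  Adj->⁻ {i} _ (inj₂ (_ , Ti)) = trans (sym (lookup≡valueAt ys i)) (Equivalence.to T-≡ Ti)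

  adj? : Decidable Adj
  adj? i j = ((toℕ i <? toℕ j) ×-dec T? (lookup ys j)) ⊎-dec ((toℕ j <? toℕ i) ×-dec T? (lookup ys i))

  adj-sym : Symmetric Adj
  adj-sym = Sum.swap

  adj-irrefl : ∀ {v} → ¬ Adj v v
  adj-irrefl (inj₁ (v<v , _)) = <-irrefl refl v<v
  adj-irrefl (inj₂ (v<v , _)) = <-irrefl refl v<v

  open Graph Adj adj? adj-sym adj-irrefl public

  ≼-true : ∀ {u w} → toℕ u < toℕ w → Y w ≡ true → u ≼ w
  ≼-true {u} {w} u<w Yw f Auf f≢w with FinP.<-cmp f w
  ... | tri< f<w _ _ = Adj->⁺ f<w Yw
  ... | tri≈ _ f≡w _ = contradiction f≡w f≢w
  ... | tri> _ _ w<f = Adj-<⁺ w<f (Adj-<⁻ (<-trans u<w w<f) Auf)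

  ≼-false : ∀ {u w} → toℕ u < toℕ w → Y w ≡ false → w ≼ u
  ≼-false {u} {w} u<w Yw f Awf _ with FinP.<-cmp f w
  ... | tri< f<w _ _ = contradiction (trans (sym Yw) (Adj->⁻ f<w Awf)) λ ()
  ... | tri≈ _ refl _ = contradiction Awf adj-irrefl
  ... | tri> _ _ w<f = Adj-<⁺ (<-trans u<w w<f) (Adj-<⁻ w<f Awf)

  ≼-total-< : ∀ {u w} → toℕ u < toℕ w → u ≼ w ⊎ w ≼ u
  ≼-total-< {w = w} u<w with Y w in Yw
  ... | true  = inj₁ (≼-true u<w Yw)
  ... | false = inj₂ (≼-false u<w Yw)

  ≼-total : ∀ u w → u ≼ w ⊎ w ≼ u
  ≼-total u w with FinP.<-cmp u w
  ... | tri< u<w _ _  = ≼-total-< u<w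
  ... | tri≈ _ refl _ = inj₁ λ _ Auf _ → Auf
  ... | tri> _ _ w<u  = Sum.swap (≼-total-< w<u)

  κ-exists : ∀ u w → u ≢ w → Σ ℕ λ c → KappaIs Adj u w (fin c)
  κ-exists u w u≢w with ≼-total u w
  ... | inj₁ u≼w = degree u , ≼⇒κ≡degree u≢w u≼w
  ... | inj₂ w≼u = degree w , KappaIs-sym (≼⇒κ≡degree (≢-sym u≢w) w≼u)

  constant⇒Twins : ∀ {u v} → toℕ u < toℕ v → (∀ f → toℕ u ≤ toℕ f → toℕ f ≤ toℕ v → Y f ≡ Y u) →
                   Twins u v
  constant⇒Twins {u} {v} u<v constant f f≢u f≢v = mk⇔ to from
    where
    Yv≡Yu : Y v ≡ Y u
    Yv≡Yu = constant v (<⇒≤ u<v) ≤-refl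
    to : Adj u f → Adj v f
    to Auf with FinP.<-cmp f u
    ... | tri≈ _ f≡u _ = contradiction f≡u f≢u
    ... | tri< f<u _ _ = Adj->⁺ (<-trans f<u u<v) (trans Yv≡Yu (Adj->⁻ f<u Auf))
    ... | tri> _ _ u<f with FinP.<-cmp f v
    ...   | tri< f<v _ _ = Adj->⁺ f<v (trans Yv≡Yu (trans (sym (constant f (<⇒≤ u<f) (<⇒≤ f<v))) (Adj-<⁻ u<f Auf)))
    ...   | tri≈ _ f≡v _ = contradiction f≡v f≢v
    ...   | tri> _ _ v<f = Adj-<⁺ v<f (Adj-<⁻ u<f Auf)
    from : Adj v f → Adj u f
    from Avf with FinP.<-cmp f v
    ... | tri≈ _ f≡v _ = contradiction f≡v f≢v
    ... | tri> _ _ v<f = Adj-<⁺ (<-trans u<v v<f) (Adj-<⁻ v<f Avf)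
    ... | tri< f<v _ _ with FinP.<-cmp f u
    ...   | tri< f<u _ _ = Adj->⁺ f<u (trans (sym Yv≡Yu) (Adj->⁻ f<v Avf))
    ...   | tri≈ _ f≡u _ = contradiction f≡u f≢u
    ...   | tri> _ _ u<f = Adj-<⁺ u<f (trans (constant f (<⇒≤ u<f) (<⇒≤ f<v)) (trans (sym Yv≡Yu) (Adj->⁻ f<v Avf)))

  runOf : Fin (length ys) → ℕ
  runOf v = runIndex ys (toℕ v)

  sameRun⇒Indistinguishable : ∀ {u v} → toℕ u < toℕ v → runOf u ≡ runOf v → Indistinguishable u v
  sameRun⇒Indistinguishable {u} {v} u<v ru≡rv =
    Twins⇒Indistinguishable (constant⇒Twins u<v λ f u≤f f≤v → runIndex-≡⇒constant ys u≤f f≤v (FinP.toℕ<n v) ru≡rv)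
                            (κ-exists u)

  sameRun-outside⇒≡ : ∀ {W u v} → Resolving Adj W → u ∉ₛ W → v ∉ₛ W → runOf u ≡ runOf v → u ≡ v
  sameRun-outside⇒≡ resolving u∉W v∉W ru≡rv with FinP.<-cmp _ _
  ... | tri< u<v _ _ = Resolving-Indistinguishable resolving (sameRun⇒Indistinguishable u<v ru≡rv) u∉W v∉W
  ... | tri≈ _ u≡v _ = u≡v
  ... | tri> _ _ v<u = sym (Resolving-Indistinguishable resolving (sameRun⇒Indistinguishable v<u (sym ru≡rv)) v∉W u∉W)

  ∣∁W∣≤runs : ∀ W → Resolving Adj W → ∣ ∁ W ∣ ≤ suc (changes ys)
  ∣∁W∣≤runs W resolving =
    injectiveOn⇒∣p∣≤ (∁ W) runOf (λ u∈ v∈ → sameRun-outside⇒≡ resolving (x∈∁p⇒x∉p u∈) (x∈∁p⇒x∉p v∈))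
                     (λ {v} _ → s≤s (runIndex≤changes ys (toℕ v)))

  private
    Adj-<⇔ : ∀ {i j} → toℕ i < toℕ j → Adj i j ⇔ Y j ≡ true
    Adj-<⇔ i<j = mk⇔ (Adj-<⁻ i<j) (Adj-<⁺ i<j)

    Adj->⇔ : ∀ {i j} → toℕ j < toℕ i → Adj i j ⇔ Y i ≡ true
    Adj->⇔ j<i = mk⇔ (Adj->⁻ j<i) (Adj->⁺ j<i)

    separates-by : ∀ {e u v b c} → e ≢ u → e ≢ v → b ≢ c → (Adj u e ⇔ b ≡ true) → (Adj v e ⇔ c ≡ true) →
                   Separates e u v
    separates-by {b = true}  {true}  _   _   b≢c _   _   = contradiction refl b≢c
    separates-by {b = true}  {false} e≢u e≢v _   Aue Ave =
      e≢u , e≢v , inj₁ (Equivalence.from Aue refl , λ A → contradiction (Equivalence.to Ave A) λ ())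
    separates-by {b = false} {true}  e≢u e≢v _   Aue Ave =
      e≢u , e≢v , inj₂ (Equivalence.from Ave refl , λ A → contradiction (Equivalence.to Aue A) λ ())
    separates-by {b = false} {false} _   _   b≢c _   _   = contradiction refl b≢c

  separates-below : ∀ {e u v} → toℕ e < toℕ u → toℕ u < toℕ v → Y u ≢ Y v → Separates e u v
  separates-below e<u u<v Yu≢Yv =
    separates-by (FinP.<⇒≢ e<u) (FinP.<⇒≢ (<-trans e<u u<v)) Yu≢Yv (Adj->⇔ e<u) (Adj->⇔ (<-trans e<u u<v))

  separates-between : ∀ {e u v} → toℕ u < toℕ e → toℕ e < toℕ v → Y e ≢ Y v → Separates e u v
  separates-between u<e e<v Ye≢Yv =
    separates-by (≢-sym (FinP.<⇒≢ u<e)) (FinP.<⇒≢ e<v) Ye≢Yv (Adj-<⇔ u<e) (Adj->⇔ e<v)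

data LastTrue (b : ℕ → Bool) (j : ℕ) : Set where
  none : (∀ i → i ≤ j → b i ≡ false) → LastTrue b j
  last : ∀ z → z ≤ j → b z ≡ true → (∀ i → z < i → i ≤ j → b i ≡ false) → LastTrue b j

lastTrue : ∀ b j → LastTrue b j
lastTrue b zero with b zero in b0
... | true  = last zero z≤n b0 λ { _ z<i z≤0 → contradiction (<-≤-trans z<i z≤0) λ () }
... | false = none λ { zero _ → b0 }
lastTrue b (suc j) with b (suc j) in b1+j
... | true  = last (suc j) ≤-refl b1+j λ _ 1+j<i i≤1+j → contradiction (<-≤-trans 1+j<i i≤1+j) (<-irrefl refl)
... | false with lastTrue b j
...   | none b≡false = none λ i i≤1+j → [ b≡false i ∘ m<1+n⇒m≤n , (λ { refl → b1+j }) ]′ (m≤n⇒m<n∨m≡n i≤1+j)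
...   | last z z≤j bz after = last z (m≤n⇒m≤1+n z≤j) bz λ i z<i i≤1+j →
          [ after i z<i ∘ m<1+n⇒m≤n , (λ { refl → b1+j }) ]′ (m≤n⇒m<n∨m≡n i≤1+j)

anchorOf : ∀ {b j} → LastTrue b j → ℕ
anchorOf (none _)       = 0
anchorOf (last z _ _ _) = z

anchorOf≤ : ∀ {b j} (lt : LastTrue b j) → anchorOf lt ≤ j
anchorOf≤ (none _)         = z≤n
anchorOf≤ (last _ z≤j _ _) = z≤j

-- Sequences ending in 1

-- The last vertex of every run is omitted, except that the final vertex is traded for its predecessor.
omitted : (ys : List Bool) → Subset (length ys)
omitted []                    = []
omitted (_ ∷ [])              = outside ∷ []
omitted (_ ∷ _ ∷ [])          = inside ∷ outside ∷ []
omitted (y ∷ ys@(y′ ∷ _ ∷ _)) = (y xor y′) ∷ omitted ys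

omitted-<-length : ∀ ys {i} → i ∈ₛ omitted ys → suc (suc (toℕ i)) ≤ length ys
omitted-<-length (_ ∷ [])                (thereₛ ())
omitted-<-length (_ ∷ _ ∷ [])            hereₛ                = ≤-refl
omitted-<-length (_ ∷ _ ∷ [])            (thereₛ (thereₛ ()))
omitted-<-length (true  ∷ false ∷ _ ∷ _) hereₛ                = s≤s (s≤s z≤n)
omitted-<-length (false ∷ true  ∷ _ ∷ _) hereₛ                = s≤s (s≤s z≤n)
omitted-<-length (_ ∷ ys@(_ ∷ _ ∷ _))    (thereₛ i∈)          = s≤s (omitted-<-length ys i∈)

omitted⇒runEnd : ∀ ys {i} → i ∈ₛ omitted ys → suc (suc (toℕ i)) < length ys →
                 valueAt ys (toℕ i) ≢ valueAt ys (suc (toℕ i))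
omitted⇒runEnd (_ ∷ _ ∷ [])            hereₛ       (s≤s (s≤s ()))
omitted⇒runEnd (true  ∷ false ∷ _ ∷ _) hereₛ       _         = λ ()
omitted⇒runEnd (false ∷ true  ∷ _ ∷ _) hereₛ       _         = λ ()
omitted⇒runEnd (_ ∷ ys@(_ ∷ _ ∷ _))    (thereₛ i∈) (s≤s i<n) = omitted⇒runEnd ys i∈ i<n

∣omitted-∷∣ : ∀ y ys → 2 ≤ length ys → ∣ omitted (y ∷ ys) ∣ ≡ changeAt y ys + ∣ omitted ys ∣
∣omitted-∷∣ _     (_ ∷ []) (s≤s ())
∣omitted-∷∣ true  (true  ∷ _ ∷ _) _ = refl
∣omitted-∷∣ true  (false ∷ _ ∷ _) _ = refl
∣omitted-∷∣ false (true  ∷ _ ∷ _) _ = refl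
∣omitted-∷∣ false (false ∷ _ ∷ _) _ = refl

∣omitted∣ : ∀ pre a b → ∣ omitted (pre ++ a ∷ b ∷ []) ∣ + changeAt a [ b ] ≡ suc (changes (pre ++ a ∷ b ∷ []))
∣omitted∣ []        a b = cong suc (sym (+-identityʳ (changeAt a [ b ])))
∣omitted∣ (y ∷ pre) a b = begin
  ∣ omitted (y ∷ ys) ∣ + c                ≡⟨ cong (_+ c) (∣omitted-∷∣ y ys 2≤length) ⟩
  changeAt y ys + ∣ omitted ys ∣ + c      ≡⟨ +-assoc (changeAt y ys) _ c ⟩
  changeAt y ys + (∣ omitted ys ∣ + c)    ≡⟨ cong (changeAt y ys +_) (∣omitted∣ pre a b) ⟩
  changeAt y ys + suc (changes ys)        ≡⟨ +-suc (changeAt y ys) (changes ys) ⟩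
  suc (changes (y ∷ ys))                  ∎
  where
  open ≡-Reasoning
  ys : List Bool
  ys = pre ++ a ∷ b ∷ []
  c : ℕ
  c = changeAt a [ b ]
  2≤length : 2 ≤ length ys
  2≤length = subst (2 ≤_) (sym (length-++ pre)) (m≤n+m 2 (length pre))

module EndsInOne (pre : List Bool) (penultimate : Bool)
                 (equal-start : valueAt (pre ++ penultimate ∷ true ∷ []) 0 ≡ valueAt (pre ++ penultimate ∷ true ∷ []) 1) where

  ys : List Bool
  ys = pre ++ penultimate ∷ true ∷ []

  open Threshold ys public

  K : ℕ
  K = length pre

  length-ys : length ys ≡ suc (suc K)
  length-ys = trans (length-++ pre) (+-comm K 2)

  value-K : valueAt ys K ≡ penultimate
  value-K = subst (λ p → valueAt ys p ≡ penultimate) (+-identityʳ K) (valueAt-++ pre _ 0)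

  value-1+K : valueAt ys (suc K) ≡ true
  value-1+K = subst (λ p → valueAt ys p ≡ true) (+-comm K 1) (valueAt-++ pre _ 1)

  final : Fin (length ys)
  final = fromℕ< (subst (suc K <_) (sym length-ys) ≤-refl)

  toℕ-final : toℕ final ≡ suc K
  toℕ-final = toℕ-fromℕ< _

  ≤K : ∀ {f} → f ≢ final → toℕ f ≤ K
  ≤K {f} f≢final = m<1+n⇒m≤n (≤∧≢⇒< (m<1+n⇒m≤n (subst (toℕ f <_) length-ys (FinP.toℕ<n f)))
                                 λ f≡1+K → f≢final (FinP.toℕ-injective (trans f≡1+K (sym toℕ-final))))

  Adj-final : ∀ {f} → f ≢ final → Adj f final
  Adj-final {f} f≢final =
    Adj-<⁺ (subst (toℕ f <_) (sym toℕ-final) (s≤s (≤K f≢final))) (trans (cong (valueAt ys) toℕ-final) value-1+K)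

  ≼-final : ∀ v → v ≼ final
  ≼-final v f _ f≢final = adj-sym (Adj-final f≢final)

  SameKappa-final⇒degree≡ : ∀ {v₁ v₂} → v₁ ≢ final → v₂ ≢ final → SameKappa Adj v₁ v₂ final →
                            degree v₁ ≡ degree v₂
  SameKappa-final⇒degree≡ v₁≢final _        (∞     , v₁≡final , _) = contradiction v₁≡final v₁≢final
  SameKappa-final⇒degree≡ v₁≢final v₂≢final (fin _ , κ₁ , κ₂)      =
    trans (KappaIs-functional (≼⇒κ≡degree v₁≢final (≼-final _)) κ₁)
          (KappaIs-functional κ₂ (≼⇒κ≡degree v₂≢final (≼-final _)))

  omitted-≤K : ∀ {i} → i ∈ₛ omitted ys → toℕ i ≤ K
  omitted-≤K {i} i∈ = s≤s⁻¹ (s≤s⁻¹ (subst (suc (suc (toℕ i)) ≤_) length-ys (omitted-<-length ys i∈)))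

  omitted≢final : ∀ {i} → i ∈ₛ omitted ys → i ≢ final
  omitted≢final i∈ refl = 1+n≰n (subst (_≤ K) toℕ-final (omitted-≤K i∈))

  -- Vertex 0 separates p and q if Y p ≢ Y q, the successor of p does otherwise; p ≢ 0 as the first run is long.
  runEnd-degree-≢ : ∀ {p q} → toℕ p < toℕ q → toℕ p < K → valueAt ys (toℕ p) ≢ valueAt ys (suc (toℕ p)) →
                    degree p ≢ degree q
  runEnd-degree-≢ {p} {q} p<q p<K runEnd with Y p Bool.≟ Y q
  ... | no Yp≢Yq  = Separates⇒degree≢ (≼-total p q) (separates-below 0<p p<q Yp≢Yq)
    where
    first : Fin (length ys)
    first = fromℕ< (subst (0 <_) (sym length-ys) z<s)
    0<p : toℕ first < toℕ p
    0<p = subst (_< toℕ p) (sym (toℕ-fromℕ< _))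
                (n≢0⇒n>0 λ p≡0 → runEnd (subst (λ i → valueAt ys i ≡ valueAt ys (suc i)) (sym p≡0) equal-start))
  ... | yes Yp≡Yq = Separates⇒degree≢ (≼-total p q) (separates-between p<next next<q Ynext≢Yq)
    where
    next : Fin (length ys)
    next = fromℕ< (subst (suc (toℕ p) <_) (sym length-ys) (s≤s (≤-trans p<K (n≤1+n K))))
    toℕ-next : toℕ next ≡ suc (toℕ p)
    toℕ-next = toℕ-fromℕ< _
    p<next : toℕ p < toℕ next
    p<next = subst (toℕ p <_) (sym toℕ-next) ≤-refl
    Ynext≢Yq : Y next ≢ Y q
    Ynext≢Yq Ynext≡Yq = runEnd (trans Yp≡Yq (trans (sym Ynext≡Yq) (cong (valueAt ys) toℕ-next)))
    next<q : toℕ next < toℕ q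
    next<q = ≤∧≢⇒< (subst (_≤ toℕ q) (sym toℕ-next) p<q) (Ynext≢Yq ∘ cong (valueAt ys))

  omitted-degree-≢ : ∀ {p q} → toℕ p < toℕ q → p ∈ₛ omitted ys → q ∈ₛ omitted ys → degree p ≢ degree q
  omitted-degree-≢ {p} p<q p∈ q∈ =
    runEnd-degree-≢ p<q p<K (omitted⇒runEnd ys p∈ (subst (suc (suc (toℕ p)) <_) (sym length-ys) (s≤s (s≤s p<K))))
    where
    p<K : toℕ p < K
    p<K = <-≤-trans p<q (omitted-≤K q∈)

  omitted-degree-injective : ∀ {p q} → p ∈ₛ omitted ys → q ∈ₛ omitted ys → degree p ≡ degree q → p ≡ q
  omitted-degree-injective {p} {q} p∈ q∈ dp≡dq with FinP.<-cmp p q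
  ... | tri< p<q _ _ = contradiction dp≡dq (omitted-degree-≢ p<q p∈ q∈)
  ... | tri≈ _ p≡q _ = p≡q
  ... | tri> _ _ q<p = contradiction (sym dp≡dq) (omitted-degree-≢ q<p q∈ p∈)

  ∁omitted-resolving : Resolving Adj (∁ (omitted ys))
  ∁omitted-resolving v₁ v₂ same with v₁ ∈? ∁ (omitted ys) | v₂ ∈? ∁ (omitted ys)
  ... | yes v₁∈W | _        = sym (SameKappa-self (same v₁ v₁∈W))
  ... | no _     | yes v₂∈W = SameKappa-self (SameKappa-sym (same v₂ v₂∈W))
  ... | no v₁∉W  | no v₂∉W  =
    omitted-degree-injective v₁∈ v₂∈
      (SameKappa-final⇒degree≡ (omitted≢final v₁∈) (omitted≢final v₂∈) (same final final∈W))
    where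
    v₁∈ : v₁ ∈ₛ omitted ys
    v₁∈ = x∉∁p⇒x∈p v₁∉W
    v₂∈ : v₂ ∈ₛ omitted ys
    v₂∈ = x∉∁p⇒x∈p v₂∉W
    final∈W : final ∈ₛ ∁ (omitted ys)
    final∈W = x∉p⇒x∈∁p λ final∈ → omitted≢final final∈ refl

  module _ (penultimate≡false : penultimate ≡ false) where

    runIndex<changes : ∀ {p} → p ≤ K → runIndex ys p < changes ys
    runIndex<changes p≤K = <-≤-trans (≤-<-trans (runIndex-mono ys p≤K) rK<r1+K) (runIndex≤changes ys (suc K))
      where
      rK<r1+K : runIndex ys K < runIndex ys (suc K)
      rK<r1+K = ≤∧≢⇒< (runIndex-mono ys (n≤1+n K)) λ rK≡r1+K →
        contradiction (begin
          false                  ≡⟨ sym (trans value-K penultimate≡false) ⟩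
          valueAt ys K           ≡⟨ runIndex-≡⇒valueAt-≡ ys (n≤1+n K) (subst (suc K <_) (sym length-ys) ≤-refl) rK≡r1+K ⟩
          valueAt ys (suc K)     ≡⟨ value-1+K ⟩
          true                   ∎) λ ()
        where open ≡-Reasoning

    no-edge-avoiding-final : (∀ i → i ≤ K → valueAt ys i ≡ false) → ∀ {w f} → w ≢ final → f ≢ final → ¬ Adj w f
    no-edge-avoiding-final false-below {w} {f} w≢final f≢final Awf with FinP.<-cmp w f
    ... | tri< w<f _ _  = contradiction (trans (sym (false-below _ (≤K f≢final))) (Adj-<⁻ w<f Awf)) λ ()
    ... | tri≈ _ refl _ = adj-irrefl Awf
    ... | tri> _ _ f<w  = contradiction (trans (sym (false-below _ (≤K w≢final))) (Adj->⁻ f<w Awf)) λ ()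

    module _ {z} (z≤K : z ≤ K) (Yz : valueAt ys z ≡ true) (after : ∀ i → z < i → i ≤ K → valueAt ys i ≡ false) where

      true⇒≤z : ∀ {v} → v ≢ final → Y v ≡ true → toℕ v ≤ z
      true⇒≤z {v} v≢final Yv with toℕ v ≤? z
      ... | yes v≤z = v≤z
      ... | no v≰z  = contradiction (trans (sym (after _ (≰⇒> v≰z) (≤K v≢final))) Yv) λ ()

      edge≤z : ∀ {w f} → w ≢ final → f ≢ final → Adj w f → toℕ f ≤ z
      edge≤z {w} {f} w≢final f≢final Awf with FinP.<-cmp w f
      ... | tri< w<f _ _  = true⇒≤z f≢final (Adj-<⁻ w<f Awf)
      ... | tri≈ _ refl _ = contradiction Awf adj-irrefl
      ... | tri> _ _ f<w  = <⇒≤ (<-≤-trans f<w (true⇒≤z w≢final (Adj->⁻ f<w Awf)))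

      z<n : z < length ys
      z<n = subst (z <_) (sym length-ys) (s≤s (≤-trans z≤K (n≤1+n K)))

      module _ {q} (q≢final : q ≢ final) (rz≡rq : runIndex ys z ≡ runOf q) where

        q≤z : toℕ q ≤ z
        q≤z with ≤-total (toℕ q) z
        ... | inj₁ q≤z = q≤z
        ... | inj₂ z≤q = true⇒≤z q≢final (trans (sym (runIndex-≡⇒valueAt-≡ ys z≤q (FinP.toℕ<n q) rz≡rq)) Yz)

        true-from-q : ∀ {i} → toℕ q ≤ i → i ≤ z → valueAt ys i ≡ true
        true-from-q q≤i i≤z =
          trans (runIndex-≡⇒constant ys q≤i i≤z z<n (sym rz≡rq))
                (trans (runIndex-≡⇒valueAt-≡ ys q≤z z<n (sym rz≡rq)) Yz)

        ≼-lastTrueRun : ∀ w → w ≢ final → w ≼ q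
        ≼-lastTrueRun w w≢final f Awf f≢q with f ≟ final
        ... | yes refl   = Adj-final q≢final
        ... | no f≢final with FinP.<-cmp f q
        ...   | tri< f<q _ _ = Adj->⁺ f<q (true-from-q ≤-refl q≤z)
        ...   | tri≈ _ f≡q _ = contradiction f≡q f≢q
        ...   | tri> _ _ q<f = Adj-<⁺ q<f (true-from-q (<⇒≤ q<f) (edge≤z w≢final f≢final Awf))

    ≼-anchorRun : (lt : LastTrue (valueAt ys) K) → ∀ {q} → q ≢ final → runIndex ys (anchorOf lt) ≡ runOf q →
                  ∀ w → w ≢ final → w ≼ q
    ≼-anchorRun (none false-below) q≢final _ w w≢final f Awf f≢q with f ≟ final
    ... | yes refl   = Adj-final q≢final
    ... | no f≢final = contradiction Awf (no-edge-avoiding-final false-below w≢final f≢final)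
    ≼-anchorRun (last z z≤K Yz after) = ≼-lastTrueRun z≤K Yz after

    private
      lt : LastTrue (valueAt ys) K
      lt = lastTrue (valueAt ys) K

    anchorRun-outside⇒≡final : ∀ {W q} → Resolving Adj W → q ∉ₛ W → final ∉ₛ W → q ≢ final →
                               runIndex ys (anchorOf lt) ≡ runOf q → q ≡ final
    anchorRun-outside⇒≡final resolving q∉W final∉W q≢final ra≡rq =
      Resolving-Indistinguishable resolving
        (≼-both⇒Indistinguishable λ w _ w≢final → ≼-anchorRun lt q≢final ra≡rq w w≢final , ≼-final w) q∉W final∉W

    -- The final vertex is charged to the run of the last 1 before position K: no other vertex tells them apart.
    collapse : ∀ v → Dec (v ≡ final) → ℕ
    collapse _ (yes _) = runIndex ys (anchorOf lt)
    collapse v (no _)  = runOf v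

    collapse-injective : ∀ {W} → Resolving Adj W → ∀ {u v} → u ∉ₛ W → v ∉ₛ W →
                         collapse u (u ≟ final) ≡ collapse v (v ≟ final) → u ≡ v
    collapse-injective resolving {u} {v} u∉W v∉W eq with u ≟ final | v ≟ final
    ... | yes u≡final | yes v≡final = trans u≡final (sym v≡final)
    ... | yes refl    | no v≢final  = sym (anchorRun-outside⇒≡final resolving v∉W u∉W v≢final eq)
    ... | no u≢final  | yes refl    = anchorRun-outside⇒≡final resolving u∉W v∉W u≢final (sym eq)
    ... | no _        | no _        = sameRun-outside⇒≡ resolving u∉W v∉W eq

    collapse<changes : ∀ v (v≟final : Dec (v ≡ final)) → collapse v v≟final < changes ys
    collapse<changes v (yes _)      = runIndex<changes (anchorOf≤ lt)
    collapse<changes v (no v≢final) = runIndex<changes (≤K v≢final)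

    ∣∁W∣≤changes : ∀ W → Resolving Adj W → ∣ ∁ W ∣ ≤ changes ys
    ∣∁W∣≤changes W resolving =
      injectiveOn⇒∣p∣≤ (∁ W) (λ v → collapse v (v ≟ final))
                       (λ u∈ v∈ → collapse-injective resolving (x∈∁p⇒x∉p u∈) (x∈∁p⇒x∉p v∈))
                       (λ {v} _ → collapse<changes v (v ≟ final))

  cdim-true : penultimate ≡ true → CDimIs Adj (length ys ∸ suc (changes ys))
  cdim-true refl =
    CDimIs-∁ (omitted ys) (trans (sym (+-identityʳ _)) (∣omitted∣ pre true true)) ∁omitted-resolving ∣∁W∣≤runs

  cdim-false : penultimate ≡ false → CDimIs Adj (length ys ∸ suc (changes ys) + 1)
  cdim-false refl = subst (CDimIs Adj) (m∸n≡m∸[1+n]+1 (changes<length ys (subst (0 <_) (sym length-ys) z<s)))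
      (CDimIs-∁ (omitted ys) (suc-injective (trans (+-comm 1 _) (∣omitted∣ pre false true)))
                ∁omitted-resolving (∣∁W∣≤changes refl))

-- Block sequences

blockSeq-suc : ∀ m (x : Fin (suc m) → Bool) k →
               blockSeq (suc m) x k ≡ replicate (k fzero) (x fzero) ++ blockSeq m (x ∘ fsuc) (k ∘ fsuc)
blockSeq-suc m x k = cong (λ bss → replicate (k fzero) (x fzero) ++ concat bss)
                          (trans (map-tabulate fsuc block) (sym (map-tabulate id (block ∘ fsuc))))
  where
  block : Fin (suc m) → List Bool
  block i = replicate (k i) (x i)

replicate-suc-++ : ∀ j (b : Bool) ys → replicate (suc j) b ++ ys ≡ replicate j b ++ b ∷ ys
replicate-suc-++ zero    b ys = refl
replicate-suc-++ (suc j) b ys = cong (b ∷_) (replicate-suc-++ j b ys)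

valueAt-replicate-++ : ∀ j b ys {p} → p < j → valueAt (replicate j b ++ ys) p ≡ b
valueAt-replicate-++ (suc j) b ys {zero}  _         = refl
valueAt-replicate-++ (suc j) b ys {suc p} (s≤s p<j) = valueAt-replicate-++ j b ys p<j

changeAt-same : ∀ b ys → changeAt b (b ∷ ys) ≡ 0
changeAt-same true  _ = refl
changeAt-same false _ = refl

changeAt-≢ : ∀ {b c} → b ≢ c → changeAt b [ c ] ≡ 1
changeAt-≢ {true}  {true}  b≢c = contradiction refl b≢c
changeAt-≢ {true}  {false} _   = refl
changeAt-≢ {false} {true}  _   = refl
changeAt-≢ {false} {false} b≢c = contradiction refl b≢c

changeAt-replicate-++ : ∀ c j b ys → 1 ≤ j → changeAt c (replicate j b ++ ys) ≡ changeAt c [ b ]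
changeAt-replicate-++ c (suc j) b ys _ = refl

changes-replicate-++ : ∀ j b ys → 1 ≤ j → changes (replicate j b ++ ys) ≡ changeAt b ys + changes ys
changes-replicate-++ (suc zero)    b ys _ = refl
changes-replicate-++ (suc (suc j)) b ys _ =
  trans (cong (_+ changes (replicate (suc j) b ++ ys)) (changeAt-same b (replicate j b ++ ys)))
        (changes-replicate-++ (suc j) b ys (s≤s z≤n))

Alternating : ∀ {m} → (Fin m → Bool) → Set
Alternating x = ∀ i j → toℕ j ≡ toℕ i + 1 → x i ≢ x j

Alternating-suc : ∀ {m} {x : Fin (suc m) → Bool} → Alternating x → Alternating (x ∘ fsuc)
Alternating-suc alternating i j j≡i+1 = alternating (fsuc i) (fsuc j) (cong suc j≡i+1)

changes-blockSeq : ∀ m (x : Fin (suc m) → Bool) k → (∀ i → 1 ≤ k i) → Alternating x →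
                   changes (blockSeq (suc m) x k) ≡ m
changes-blockSeq zero    x k positive _           = changes-replicate-++ (k fzero) (x fzero) [] (positive fzero)
changes-blockSeq (suc m) x k positive alternating = begin
  changes (blockSeq (suc (suc m)) x k)             ≡⟨ cong changes (blockSeq-suc (suc m) x k) ⟩
  changes (replicate (k fzero) (x fzero) ++ rest)  ≡⟨ changes-replicate-++ (k fzero) (x fzero) rest (positive fzero) ⟩
  changeAt (x fzero) rest + changes rest           ≡⟨ cong₂ _+_ boundary changes-rest ⟩
  suc m                                            ∎
  where
  open ≡-Reasoning
  rest : List Bool
  rest = blockSeq (suc m) (x ∘ fsuc) (k ∘ fsuc)
  boundary : changeAt (x fzero) rest ≡ 1
  boundary = begin
    changeAt (x fzero) rest
      ≡⟨ cong (changeAt (x fzero)) (blockSeq-suc m (x ∘ fsuc) (k ∘ fsuc)) ⟩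
    changeAt (x fzero) (replicate (k (fsuc fzero)) (x (fsuc fzero)) ++ _)
      ≡⟨ changeAt-replicate-++ (x fzero) _ _ _ (positive (fsuc fzero)) ⟩
    changeAt (x fzero) [ x (fsuc fzero) ]
      ≡⟨ changeAt-≢ (alternating fzero (fsuc fzero) refl) ⟩
    1 ∎
  changes-rest : changes rest ≡ m
  changes-rest = changes-blockSeq m (x ∘ fsuc) (k ∘ fsuc) (positive ∘ fsuc) (Alternating-suc alternating)

blockSeq-equal-start : ∀ m (x : Fin (suc m) → Bool) k → 2 ≤ k fzero →
                       valueAt (blockSeq (suc m) x k) 0 ≡ valueAt (blockSeq (suc m) x k) 1
blockSeq-equal-start m x k 2≤k = subst (λ ys → valueAt ys 0 ≡ valueAt ys 1) (sym (blockSeq-suc m x k))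
  (trans (valueAt-replicate-++ (k fzero) (x fzero) _ (≤-trans (s≤s z≤n) 2≤k))
         (sym (valueAt-replicate-++ (k fzero) (x fzero) _ 2≤k)))

EndsWith : List Bool → List Bool → Set
EndsWith ys s = Σ (List Bool) λ pre → ys ≡ pre ++ s

EndsWith-blockSeq-suc : ∀ m (x : Fin (suc m) → Bool) k {s} → EndsWith (blockSeq m (x ∘ fsuc) (k ∘ fsuc)) s →
                        EndsWith (blockSeq (suc m) x k) s
EndsWith-blockSeq-suc m x k {s} (pre , eq) = block ++ pre , (begin
  blockSeq (suc m) x k                          ≡⟨ blockSeq-suc m x k ⟩
  block ++ blockSeq m (x ∘ fsuc) (k ∘ fsuc)     ≡⟨ cong (block ++_) eq ⟩
  block ++ pre ++ s                             ≡⟨ sym (++-assoc block pre s) ⟩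
  (block ++ pre) ++ s                           ∎)
  where
  open ≡-Reasoning
  block : List Bool
  block = replicate (k fzero) (x fzero)

replicate-endsWith-long : ∀ j (b : Bool) → 2 ≤ j → EndsWith (replicate j b ++ []) (b ∷ b ∷ [])
replicate-endsWith-long (suc zero)    b (s≤s ())
replicate-endsWith-long (suc (suc j)) b _ =
  replicate j b , trans (replicate-suc-++ (suc j) b []) (replicate-suc-++ j b [ b ])

replicate-++-endsWith : ∀ j (b c : Bool) → 1 ≤ j → EndsWith (replicate j b ++ c ∷ []) (b ∷ c ∷ [])
replicate-++-endsWith (suc j) b c _ = replicate j b , replicate-suc-++ j b [ c ]

blockSeq-endsWith-long : ∀ m (x : Fin (suc m) → Bool) k → 2 ≤ k (fromℕ m) →
                         EndsWith (blockSeq (suc m) x k) (x (fromℕ m) ∷ x (fromℕ m) ∷ [])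
blockSeq-endsWith-long zero    x k 2≤k = replicate-endsWith-long (k fzero) (x fzero) 2≤k
blockSeq-endsWith-long (suc m) x k 2≤k =
  EndsWith-blockSeq-suc (suc m) x k (blockSeq-endsWith-long m (x ∘ fsuc) (k ∘ fsuc) 2≤k)

blockSeq-endsWith-lastTwo : ∀ m (x : Fin (suc (suc m)) → Bool) k → (∀ i → 1 ≤ k i) → k (fromℕ (suc m)) ≡ 1 →
                          EndsWith (blockSeq (suc (suc m)) x k) (x (inject₁ (fromℕ m)) ∷ x (fromℕ (suc m)) ∷ [])
blockSeq-endsWith-lastTwo zero    x k positive k≡1 =
  subst (λ j → EndsWith (replicate (k fzero) (x fzero) ++ replicate j (x (fsuc fzero)) ++ [])
                        (x fzero ∷ x (fsuc fzero) ∷ []))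
        (sym k≡1) (replicate-++-endsWith (k fzero) (x fzero) (x (fsuc fzero)) (positive fzero))
blockSeq-endsWith-lastTwo (suc m) x k positive k≡1 =
  EndsWith-blockSeq-suc (suc (suc m)) x k (blockSeq-endsWith-lastTwo m (x ∘ fsuc) (k ∘ fsuc) (positive ∘ fsuc) k≡1)

blockSeq-endsWith-single : ∀ m (x : Fin (suc m) → Bool) k → (∀ i → 1 ≤ k i) → Alternating x → 2 ≤ k fzero →
                           k (fromℕ m) ≡ 1 → EndsWith (blockSeq (suc m) x k) (not (x (fromℕ m)) ∷ x (fromℕ m) ∷ [])
blockSeq-endsWith-single zero    x k _        _           2≤k k≡1 = contradiction (subst (2 ≤_) k≡1 2≤k) λ { (s≤s ()) }
blockSeq-endsWith-single (suc m) x k positive alternating _   k≡1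
  with pre , eq ← blockSeq-endsWith-lastTwo m x k positive k≡1 =
  pre , subst (λ b → blockSeq (suc (suc m)) x k ≡ pre ++ b ∷ x (fromℕ (suc m)) ∷ []) (¬-not alternate) eq
  where
  alternate : x (inject₁ (fromℕ m)) ≢ x (fromℕ (suc m))
  alternate = alternating _ _ (begin
    toℕ (fromℕ (suc m))          ≡⟨ toℕ-fromℕ (suc m) ⟩
    suc m                        ≡⟨ +-comm 1 m ⟩
    m + 1                        ≡⟨ cong (_+ 1) (sym (trans (toℕ-inject₁ (fromℕ m)) (toℕ-fromℕ m))) ⟩
    toℕ (inject₁ (fromℕ m)) + 1  ∎)
    where open ≡-Reasoning

module BlockSequence (m : ℕ) (x : Fin (suc m) → Bool) (k : Fin (suc m) → ℕ)
                     (positive : ∀ i → 1 ≤ k i) (alternating : Alternating x) (first-long : 2 ≤ k fzero)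
                     (last-one : x (fromℕ m) ≡ true) where

  ys : List Bool
  ys = blockSeq (suc m) x k

  private
    changes-ys : ∀ {zs} → ys ≡ zs → changes zs ≡ m
    changes-ys refl = changes-blockSeq m x k positive alternating

    equal-start : ∀ {zs} → ys ≡ zs → valueAt zs 0 ≡ valueAt zs 1
    equal-start refl = blockSeq-equal-start m x k first-long

  cdim-long : 2 ≤ k (fromℕ m) → CDimIs (ThAdj ys) (length ys ∸ suc m)
  cdim-long 2≤k with pre , ys≡ ← blockSeq-endsWith-long m x k 2≤k =
    subst₂ (λ zs c → CDimIs (ThAdj zs) (length zs ∸ suc c)) (sym ys≡′) (changes-ys ys≡′)
           (EndsInOne.cdim-true pre true (equal-start ys≡′) refl)
    where
    ys≡′ : ys ≡ pre ++ true ∷ true ∷ []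
    ys≡′ = subst (λ b → ys ≡ pre ++ b ∷ b ∷ []) last-one ys≡

  cdim-single : k (fromℕ m) ≡ 1 → CDimIs (ThAdj ys) (length ys ∸ suc m + 1)
  cdim-single k≡1 with pre , ys≡ ← blockSeq-endsWith-single m x k positive alternating first-long k≡1 =
    subst₂ (λ zs c → CDimIs (ThAdj zs) (length zs ∸ suc c + 1)) (sym ys≡′) (changes-ys ys≡′)
           (EndsInOne.cdim-false pre false (equal-start ys≡′) refl)
    where
    ys≡′ : ys ≡ pre ++ false ∷ true ∷ []
    ys≡′ = subst (λ b → ys ≡ pre ++ not b ∷ b ∷ []) last-one ys≡

theorem2p6 : (m : ℕ) (x : Fin m → Bool) (k : Fin m → ℕ)
    → 1 ≤ m
    → (∀ i → 1 ≤ k i)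
    → (∀ i j → toℕ j ≡ toℕ i + 1 → x i ≢ x j)
    → (∀ i → toℕ i + 1 ≡ m → x i ≡ true)
    → (∀ i → toℕ i ≡ 0 → 2 ≤ k i)
    → (∀ i → toℕ i + 1 ≡ m →
         (1 < k i → CDimIs (ThAdj (blockSeq m x k)) (length (blockSeq m x k) ∸ m))
         × (k i ≡ 1 → CDimIs (ThAdj (blockSeq m x k)) (length (blockSeq m x k) ∸ m + 1)))
theorem2p6 (suc m) x k _ positive alternating last-one first-long i i+1≡m =
  cdim-long ∘ subst (λ j → 2 ≤ k j) i≡last , cdim-single ∘ subst (λ j → k j ≡ 1) i≡last
  where
  last+1≡m : toℕ (fromℕ m) + 1 ≡ suc m
  last+1≡m = trans (cong (_+ 1) (toℕ-fromℕ m)) (+-comm m 1)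
  i≡last : i ≡ fromℕ m
  i≡last = FinP.toℕ-injective (+-cancelʳ-≡ 1 _ _ (trans i+1≡m (sym last+1≡m)))
  open BlockSequence m x k positive alternating (first-long fzero refl) (last-one (fromℕ m) last+1≡m)
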